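{- Let $G$ be a graph of order $n\ge 2$ with at least one edge. The following are equivalent: (1) $G\cong K_{n-r}\sqcup rK_1$ for some $r\ge 0$ with $n-r\ge 2$ (a complete graph on $n-r$ vertices together with $r$ isolated vertices); (2) $\operatorname{z_+ir}(G)=n-1$; (3) $\operatorname{Z}_+(G)=n-1$; (4) $\overline{\operatorname{Z}}_+(G)=n-1$; (5) $\operatorname{Z_+IR}(G)=n-1$.
   Context: Graphs are finite, simple, undirected. PSD color change rule: given a set $B$ of blue vertices (the rest white), let $W_1,\dots,W_k$ be the vertex sets of the connected components of $G-B$; if $u\in B$, $w\in W_i$, and $w$ is the only white neighbor of $u$ in $G[W_i\cup B]$, then $u$ can change $w$ to blue. A PSD forcing set is a set $S$ such that starting with exactly $S$ blue and applying the rule until no change is possible colors all of $V(G)$ blue. $\operatorname{Z}_+(G)$ is the minimum cardinality of a PSD forcing set and $\overline{\operatorname{Z}}_+(G)$ the maximum cardinality of a minimal PSD forcing set. A (standard) fort is a nonempty $F\subseteq V(G)$ with $|F\cap N(v)|\ne1$ for all $v\notin F$; a nonempty $F$ is a PSD fort if the vertex set of each connected component of $G[F]$ is a standard fort of $G$. $S$ is a $\operatorname{Z}_+$Ir-set if each $u\in S$ has a PSD fort $F$ with $S\cap F=\{u\}$. $\operatorname{Z_+IR}(G)$ is the maximum cardinality of a $\operatorname{Z}_+$Ir-set and $\operatorname{z_+ir}(G)$ the minimum cardinality of a maximal (w.r.t. inclusion) $\operatorname{Z}_+$Ir-set. -}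

module Defs where

open import Data.Nat using (ℕ; _≤_; _<ᵇ_; _∸_)
open import Data.Bool using (Bool; true; false; _∧_; not)
open import Data.Fin using (Fin; toℕ; _≟_)
open import Data.Fin.Subset using (Subset; _∈_; _∉_; _⊆_; _⊂_; ∁; _∩_; _∪_; ∣_∣; Nonempty; ⁅_⁆; ⊤)
open import Data.Vec using (tabulate)
open import Data.Product using (Σ; ∃; _×_)
open import Function.Bundles using (_↔_; Inverse)
open import Relation.Binary.PropositionalEquality using (_≡_; _≢_; refl) renaming (sym to ≡sym)
open import Data.Bool.Properties using (∧-comm)
open import Data.Empty using (⊥-elim)
open import Relation.Nullary using (¬_; does; yes; no)

record Graph (n : ℕ) : Set where
  field
    adj    : Fin n → Fin n → Bool
    sym    : ∀ i j → adj i j ≡ adj j i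
    irrefl : ∀ i → adj i i ≡ false
open Graph public

module _ {n : ℕ} (G : Graph n) where

  HasEdge : Set
  HasEdge = ∃ λ i → ∃ λ j → adj G i j ≡ true

  N : Fin n → Subset n
  N v = tabulate (adj G v)

  data Path (C : Subset n) : Fin n → Fin n → Set where
    here : ∀ {x} → x ∈ C → Path C x x
    step : ∀ {x z y} → x ∈ C → adj G x z ≡ true → Path C z y → Path C x y

  -- C is the vertex set of a connected component of G[F]
  IsComponent : Subset n → Subset n → Set
  IsComponent F C =
    Nonempty C × C ⊆ F
    × (∀ x y → x ∈ C → y ∈ C → Path C x y)
    × (∀ x y → x ∈ C → y ∈ F → adj G x y ≡ true → y ∈ C)

  -- PSD color change rule: u (blue) changes w (white) to blue
  PSDForce : Subset n → Fin n → Fin n → Set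
  PSDForce B u w =
    u ∈ B × w ∉ B × adj G u w ≡ true ×
    ∃ λ W → IsComponent (∁ B) W × w ∈ W ×
      (∀ w' → w' ∈ W → adj G u w' ≡ true → w' ≡ w)

  data PSDReach (S : Subset n) : Subset n → Set where
    start : PSDReach S S
    force : ∀ {B u w} → PSDReach S B → PSDForce B u w → PSDReach S (B ∪ ⁅ w ⁆)

  Stalled : Subset n → Set
  Stalled B = ∀ u w → ¬ PSDForce B u w

  -- starting from S and applying the rule until no change is possible
  -- (in any order) colors all vertices blue
  IsPSDForcingSet : Subset n → Set
  IsPSDForcingSet S = ∀ B → PSDReach S B → Stalled B → B ≡ ⊤

  IsMinimalPSDForcingSet : Subset n → Set
  IsMinimalPSDForcingSet S = IsPSDForcingSet S × (∀ T → T ⊂ S → ¬ IsPSDForcingSet T)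

  IsFort : Subset n → Set
  IsFort F = Nonempty F × (∀ v → v ∉ F → ∣ F ∩ N v ∣ ≢ 1)

  IsPSDFort : Subset n → Set
  IsPSDFort F = Nonempty F × (∀ C → IsComponent F C → IsFort C)

  IsZ+IrSet : Subset n → Set
  IsZ+IrSet S = ∀ u → u ∈ S → ∃ λ F → IsPSDFort F × S ∩ F ≡ ⁅ u ⁆

  IsMaximalZ+IrSet : Subset n → Set
  IsMaximalZ+IrSet S = IsZ+IrSet S × (∀ T → S ⊂ T → ¬ IsZ+IrSet T)

MinCard : {n : ℕ} → (Subset n → Set) → ℕ → Set
MinCard P k = (∃ λ S → P S × ∣ S ∣ ≡ k) × (∀ S → P S → k ≤ ∣ S ∣)

MaxCard : {n : ℕ} → (Subset n → Set) → ℕ → Set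
MaxCard P k = (∃ λ S → P S × ∣ S ∣ ≡ k) × (∀ S → P S → ∣ S ∣ ≤ k)

Zplus≡ : {n : ℕ} → Graph n → ℕ → Set
Zplus≡ G = MinCard (IsPSDForcingSet G)

ZplusBar≡ : {n : ℕ} → Graph n → ℕ → Set
ZplusBar≡ G = MaxCard (IsMinimalPSDForcingSet G)

Z+IR≡ : {n : ℕ} → Graph n → ℕ → Set
Z+IR≡ G = MaxCard (IsZ+IrSet G)

z+ir≡ : {n : ℕ} → Graph n → ℕ → Set
z+ir≡ G = MinCard (IsMaximalZ+IrSet G)

-- K_m ⊔ (n - m) K_1 on vertex set Fin n: vertices with index < m form a clique,
-- the remaining vertices are isolated
KplusIsolated : (n m : ℕ) → Graph n
KplusIsolated n m = record
  { adj = λ i j → not (does (i ≟ j)) ∧ (toℕ i <ᵇ m) ∧ (toℕ j <ᵇ m)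
  ; sym = symP
  ; irrefl = irr }
  where
  symP : ∀ i j → (not (does (i ≟ j)) ∧ (toℕ i <ᵇ m) ∧ (toℕ j <ᵇ m))
               ≡ (not (does (j ≟ i)) ∧ (toℕ j <ᵇ m) ∧ (toℕ i <ᵇ m))
  symP i j with i ≟ j | j ≟ i
  ... | yes _ | yes _ = refl
  ... | yes p | no ¬q = ⊥-elim (¬q (≡sym p))
  ... | no ¬p | yes q = ⊥-elim (¬p (≡sym q))
  ... | no _  | no _  = ∧-comm (toℕ i <ᵇ m) (toℕ j <ᵇ m)
  irr : ∀ i → (not (does (i ≟ i)) ∧ (toℕ i <ᵇ m) ∧ (toℕ i <ᵇ m)) ≡ false
  irr i with i ≟ i
  ... | yes _ = refl
  ... | no ¬p = ⊥-elim (¬p refl)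

_≅_ : {n : ℕ} → Graph n → Graph n → Set
_≅_ {n} G H = Σ (Fin n ↔ Fin n) λ f →
  ∀ i j → adj G i j ≡ adj H (Inverse.to f i) (Inverse.to f j)

-- All five conditions are equivalent to: the non-isolated vertices of G are pairwise adjacent;
-- sorting the non-isolated vertices to the front turns this into an isomorphism with K_m ⊔ (n − m)K₁.
-- Under the condition, the complement of one non-isolated vertex attains n − 1 for all four
-- parameters: a PSD forcing set missing two vertices would leave no white non-isolated vertex, or two
-- (then nothing can be forced), or one, after whose forcing nothing more happens; and a set is
-- Z₊-irredundant exactly when it contains no non-isolated vertex or misses one, so a maximal one misses
-- at most one vertex. Conversely, let S of size n − 1 miss only w. If S is Z₊-irredundant, the PSD
-- fort isolating a non-isolated u ≠ w in S must be {u, w}, so u and w are adjacent twins. If two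
-- non-isolated vertices are non-adjacent, the complement of a suitable pair is a PSD forcing set of
-- size n − 2, lying inside S when S is a minimal PSD forcing set.

module Submission where

open import Defs
open import Data.Nat using (ℕ; _≤_; _∸_)
open import Data.Product using (∃; _×_)
open import Function.Bundles using (_⇔_)

open import Data.Bool using (Bool; true; false; _∧_; not; if_then_else_) renaming (_≟_ to _≟ᵇ_)
open import Data.Bool.Properties using (¬-not; T-≡)
open import Data.Empty using (⊥; ⊥-elim)
open import Data.Fin using (Fin; zero; suc; toℕ; fromℕ<; punchIn; _≟_)
open import Data.Fin.Permutation using (Permutation; _⟨$⟩ʳ_; insert; insert-punchIn)
import Data.Fin.Permutation as Permutation
open import Data.Fin.Properties using (any?; toℕ-fromℕ<; toℕ-injective)
open import Data.Vec.Properties using (lookup⇒[]=; []=⇒lookup; lookup∘tabulate)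
open import Data.Fin.Subset using (Subset; _∈_; _∉_; _⊆_; _⊂_; ∁; _∩_; _∪_; ∣_∣; Nonempty; ⁅_⁆; ⊤)
open import Data.Fin.Subset.Properties
  using (_∈?_; nonempty?; Empty-unique; ⊆-antisym; ∈⊤; ∣⊤∣≡n; ∣⊥∣≡0; ∣p∣≤n; ∣p∣≡n⇒p≡⊤; ∣⁅x⁆∣≡1;
         x∈⁅x⁆; x∈⁅y⁆⇒x≡y; x≢y⇒x∉⁅y⁆; p⊆q⇒∣p∣≤∣q∣; p⊂q⇒∣p∣<∣q∣; ∣∁p∣≡n∸∣p∣;
         x∈p⇒x∉∁p; x∈∁p⇒x∉p; x∉∁p⇒x∈p; x∉p⇒x∈∁p; p⊆p∪q; ∪-comm; x∈p∪q⁺; x∈p∪q⁻; x∈p∩q⁺; x∈p∩q⁻)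
open import Data.Nat using (zero; suc; _<_; _<ᵇ_; z≤n; s≤s)
open import Data.Nat.Properties using (≤∧≢⇒<; <⇒≤pred; <⇒≱; <⇒≢; m∸n≤m; m≤n⇒m≤1+n; 1+n≢n; <ᵇ⇒<; m∸[m∸n]≡n; ≤-trans)
open import Data.Product using (_,_; proj₁; proj₂)
open import Data.Sum using (_⊎_; inj₁; inj₂; [_,_]′)
import Data.Sum as Sum
open import Function using (_∘_)
open import Function.Bundles using (mk⇔; Equivalence; Injection; Inverse)
open import Function.Construct.Composition using (_⇔-∘_)
open import Function.Properties.Inverse using (↔⇒↣)
open import Relation.Nullary using (¬_; Dec; yes; no; does)
open import Relation.Nullary.Decidable using (decidable-stable; ¬?; _×-dec_; dec-true; dec-false)
open import Relation.Binary.PropositionalEquality using (_≡_; _≢_; refl; trans; cong; subst; subst₂; module ≡-Reasoning)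
  renaming (sym to ≡-sym)

module _ {n : ℕ} where

  ∀∈⇒≡⊤ : {p : Subset n} → (∀ x → x ∈ p) → p ≡ ⊤
  ∀∈⇒≡⊤ h = ⊆-antisym (λ _ → ∈⊤) (λ {x} _ → h x)

  p≡⊤⇒x∈p : {p : Subset n} {x : Fin n} → p ≡ ⊤ → x ∈ p
  p≡⊤⇒x∈p refl = ∈⊤

  ¬∉⇒∈ : {p : Subset n} {x : Fin n} → ¬ x ∉ p → x ∈ p
  ¬∉⇒∈ {p} {x} = decidable-stable (x ∈? p)

  x∈⁅y⁆∪⁅z⁆⁺ : {x y z : Fin n} → x ≡ y ⊎ x ≡ z → x ∈ ⁅ y ⁆ ∪ ⁅ z ⁆
  x∈⁅y⁆∪⁅z⁆⁺ (inj₁ refl) = x∈p∪q⁺ (inj₁ (x∈⁅x⁆ _))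
  x∈⁅y⁆∪⁅z⁆⁺ (inj₂ refl) = x∈p∪q⁺ (inj₂ (x∈⁅x⁆ _))

  x∈⁅y⁆∪⁅z⁆⁻ : {x y z : Fin n} → x ∈ ⁅ y ⁆ ∪ ⁅ z ⁆ → x ≡ y ⊎ x ≡ z
  x∈⁅y⁆∪⁅z⁆⁻ {y = y} {z} h = Sum.map (x∈⁅y⁆⇒x≡y y) (x∈⁅y⁆⇒x≡y z) (x∈p∪q⁻ ⁅ y ⁆ ⁅ z ⁆ h)

  x∉∁⁅y⁆∪⁅z⁆ : {x y z : Fin n} → x ∉ ∁ (⁅ y ⁆ ∪ ⁅ z ⁆) → x ≡ y ⊎ x ≡ z
  x∉∁⁅y⁆∪⁅z⁆ = x∈⁅y⁆∪⁅z⁆⁻ ∘ x∉∁p⇒x∈p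

  x∈p∪⁅y⁆⇒x≡y : {p : Subset n} {x y : Fin n} → x ∈ p ∪ ⁅ y ⁆ → x ∉ p → x ≡ y
  x∈p∪⁅y⁆⇒x≡y {p} {y = y} h x∉p = [ ⊥-elim ∘ x∉p , x∈⁅y⁆⇒x≡y y ]′ (x∈p∪q⁻ p ⁅ y ⁆ h)

  x∉p∪⁅y⁆ : {p : Subset n} {x y : Fin n} → x ∉ p → x ≢ y → x ∉ p ∪ ⁅ y ⁆
  x∉p∪⁅y⁆ x∉p x≢y h = x≢y (x∈p∪⁅y⁆⇒x≡y h x∉p)

  p⊂p∪⁅x⁆ : {p : Subset n} {x : Fin n} → x ∉ p → p ⊂ p ∪ ⁅ x ⁆
  p⊂p∪⁅x⁆ {x = x} x∉p = p⊆p∪q ⁅ x ⁆ , x , x∈p∪q⁺ (inj₂ (x∈⁅x⁆ x)) , x∉p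

  ∁⁅x⁆⊂p⇒p≡⊤ : {p : Subset n} {x : Fin n} → ∁ ⁅ x ⁆ ⊂ p → p ≡ ⊤
  ∁⁅x⁆⊂p⇒p≡⊤ {p} {x} (∁⁅x⁆⊆p , y , y∈p , y∉∁⁅x⁆) = ∀∈⇒≡⊤ λ z → ¬∉⇒∈ λ z∉p →
    z∉p (∁⁅x⁆⊆p (x∉p⇒x∈∁p λ z∈⁅x⁆ →
      z∉p (subst (_∈ p) (trans (x∈⁅y⁆⇒x≡y x (x∉∁p⇒x∈p y∉∁⁅x⁆)) (≡-sym (x∈⁅y⁆⇒x≡y x z∈⁅x⁆))) y∈p)))

  p≡⁅x⁆⁺ : {p : Subset n} {x : Fin n} → x ∈ p → (∀ {y} → y ∈ p → y ≡ x) → p ≡ ⁅ x ⁆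
  p≡⁅x⁆⁺ {p} {x} x∈p unique = ⊆-antisym
    (λ y∈p → subst (_∈ ⁅ x ⁆) (≡-sym (unique y∈p)) (x∈⁅x⁆ x))
    (λ y∈⁅x⁆ → subst (_∈ p) (≡-sym (x∈⁅y⁆⇒x≡y x y∈⁅x⁆)) x∈p)

  p∩q≡⁅x⁆⁺ : {p q : Subset n} {x : Fin n} → x ∈ p → x ∈ q → (∀ {y} → y ∈ p → y ∈ q → y ≡ x) → p ∩ q ≡ ⁅ x ⁆
  p∩q≡⁅x⁆⁺ {p} {q} x∈p x∈q unique = p≡⁅x⁆⁺ (x∈p∩q⁺ (x∈p , x∈q)) λ y∈p∩q →
    let (y∈p , y∈q) = x∈p∩q⁻ p q y∈p∩q in unique y∈p y∈q

  p∩q≡⁅x⁆⇒x∈q : {p q : Subset n} {x : Fin n} → p ∩ q ≡ ⁅ x ⁆ → x ∈ q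
  p∩q≡⁅x⁆⇒x∈q {p} {q} {x} eq = proj₂ (x∈p∩q⁻ p q (subst (x ∈_) (≡-sym eq) (x∈⁅x⁆ x)))

  p∩q≡⁅x⁆⇒≡x : {p q : Subset n} {x y : Fin n} → p ∩ q ≡ ⁅ x ⁆ → y ∈ p → y ∈ q → y ≡ x
  p∩q≡⁅x⁆⇒≡x {x = x} eq y∈p y∈q = x∈⁅y⁆⇒x≡y x (subst (_ ∈_) eq (x∈p∩q⁺ (y∈p , y∈q)))

  ⁅x⁆⊆p : {p : Subset n} {x : Fin n} → x ∈ p → ⁅ x ⁆ ⊆ p
  ⁅x⁆⊆p {p} {x} x∈p y∈⁅x⁆ = subst (_∈ p) (≡-sym (x∈⁅y⁆⇒x≡y x y∈⁅x⁆)) x∈p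

  ∣p∣≡1⇒unique : {p : Subset n} → ∣ p ∣ ≡ 1 → ∃ λ x → x ∈ p × (∀ {y} → y ∈ p → y ≡ x)
  ∣p∣≡1⇒unique {p} ∣p∣≡1 with nonempty? p
  ... | no empty with () ← trans (≡-sym (trans (cong ∣_∣ (Empty-unique empty)) (∣⊥∣≡0 n))) ∣p∣≡1
  ... | yes (x , x∈p) = x , x∈p , λ {y} y∈p → decidable-stable (y ≟ x) λ y≢x →
    <⇒≢ (subst (_< ∣ p ∣) (∣⁅x⁆∣≡1 x) (p⊂q⇒∣p∣<∣q∣ (⁅x⁆⊆p x∈p , y , y∈p , x≢y⇒x∉⁅y⁆ y≢x))) (≡-sym ∣p∣≡1)

  ∣∁⁅x⁆∣≡n∸1 : (x : Fin n) → ∣ ∁ ⁅ x ⁆ ∣ ≡ n ∸ 1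
  ∣∁⁅x⁆∣≡n∸1 x = trans (∣∁p∣≡n∸∣p∣ ⁅ x ⁆) (cong (n ∸_) (∣⁅x⁆∣≡1 x))

  p≢⊤⇒∣p∣≤n∸1 : {p : Subset n} → p ≢ ⊤ → ∣ p ∣ ≤ n ∸ 1
  p≢⊤⇒∣p∣≤n∸1 {p} p≢⊤ = <⇒≤pred (≤∧≢⇒< (∣p∣≤n p) (p≢⊤ ∘ ∣p∣≡n⇒p≡⊤))

  twoOutside⇒∣p∣<n∸1 : {p : Subset n} {x y : Fin n} → x ≢ y → x ∉ p → y ∉ p → ∣ p ∣ < n ∸ 1
  twoOutside⇒∣p∣<n∸1 {p} {x} {y} x≢y x∉p y∉p =
    subst (∣ p ∣ <_) (∣∁⁅x⁆∣≡n∸1 x) (p⊂q⇒∣p∣<∣q∣ (p⊆∁⁅x⁆ , y , x∉p⇒x∈∁p (x≢y⇒x∉⁅y⁆ (x≢y ∘ ≡-sym)) , y∉p))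
    where
    p⊆∁⁅x⁆ : p ⊆ ∁ ⁅ x ⁆
    p⊆∁⁅x⁆ z∈p = x∉p⇒x∈∁p λ z∈⁅x⁆ → x∉p (subst (_∈ p) (x∈⁅y⁆⇒x≡y x z∈⁅x⁆) z∈p)

  AtMostOneOutside : Subset n → Set
  AtMostOneOutside p = ∀ {x y} → x ∉ p → y ∉ p → x ≡ y

  atMostOneOutside⇒n∸1≤∣p∣ : {p : Subset n} → AtMostOneOutside p → n ∸ 1 ≤ ∣ p ∣
  atMostOneOutside⇒n∸1≤∣p∣ {p} oneOutside with any? (λ x → ¬? (x ∈? p))
  ... | yes (x , x∉p) = subst (_≤ ∣ p ∣) (∣∁⁅x⁆∣≡n∸1 x) (p⊆q⇒∣p∣≤∣q∣ ∁⁅x⁆⊆p)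
    where
    ∁⁅x⁆⊆p : ∁ ⁅ x ⁆ ⊆ p
    ∁⁅x⁆⊆p z∈∁⁅x⁆ = ¬∉⇒∈ λ z∉p → x∈∁p⇒x∉p z∈∁⁅x⁆ (subst (_∈ ⁅ x ⁆) (oneOutside x∉p z∉p) (x∈⁅x⁆ x))
  ... | no noneOutside = subst (n ∸ 1 ≤_) (≡-sym (trans (cong ∣_∣ p≡⊤) (∣⊤∣≡n n))) (m∸n≤m n 1)
    where
    p≡⊤ : p ≡ ⊤
    p≡⊤ = ∀∈⇒≡⊤ λ x → ¬∉⇒∈ λ x∉p → noneOutside (x , x∉p)

  ∣p∣≡n∸1⇒oneOutside : {p : Subset n} → 0 < n → ∣ p ∣ ≡ n ∸ 1 → ∃ λ w → w ∉ p × (∀ {z} → z ∉ p → z ≡ w)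
  ∣p∣≡n∸1⇒oneOutside {p} (s≤s z≤n) ∣p∣≡n∸1 with any? (λ x → ¬? (x ∈? p))
  ... | yes (w , w∉p) = w , w∉p , λ {z} z∉p → decidable-stable (z ≟ w) λ z≢w →
    <⇒≢ (twoOutside⇒∣p∣<n∸1 z≢w z∉p w∉p) ∣p∣≡n∸1
  ... | no noneOutside = ⊥-elim (1+n≢n (trans (≡-sym (trans (cong ∣_∣ p≡⊤) (∣⊤∣≡n n))) ∣p∣≡n∸1))
    where
    p≡⊤ : p ≡ ⊤
    p≡⊤ = ∀∈⇒≡⊤ λ x → ¬∉⇒∈ λ x∉p → noneOutside (x , x∉p)

x≡true⇔y≡true⇒x≡y : ∀ {x y} → (x ≡ true → y ≡ true) → (y ≡ true → x ≡ true) → x ≡ y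
x≡true⇔y≡true⇒x≡y {false} {false} _ _ = refl
x≡true⇔y≡true⇒x≡y {false} {true}  _ y⇒x = y⇒x refl
x≡true⇔y≡true⇒x≡y {true}  {false} x⇒y _ = ≡-sym (x⇒y refl)
x≡true⇔y≡true⇒x≡y {true}  {true}  _ _ = refl

x∧y∧z≡true⇒y≡true : ∀ x y z → x ∧ y ∧ z ≡ true → y ≡ true
x∧y∧z≡true⇒y≡true true true _ _ = refl

not[x]∧y∧z≡true : ∀ {x y z} → x ≡ false → y ≡ true → z ≡ true → not x ∧ y ∧ z ≡ true
not[x]∧y∧z≡true refl refl refl = refl

distinct-<⇒2≤ : ∀ {x y m} → x < m → y < m → x ≢ y → 2 ≤ m
distinct-<⇒2≤ {zero}  {zero}  _             _             x≢y = ⊥-elim (x≢y refl)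
distinct-<⇒2≤ {zero}  {suc _} _             (s≤s (s≤s _)) _   = s≤s (s≤s z≤n)
distinct-<⇒2≤ {suc _}         (s≤s (s≤s _)) _             _   = s≤s (s≤s z≤n)

n<ᵇn≡false : ∀ k → (k <ᵇ k) ≡ false
n<ᵇn≡false zero    = refl
n<ᵇn≡false (suc k) = n<ᵇn≡false k

toℕ-punchIn-<ᵇ : ∀ {n} (j : Fin (suc n)) (x : Fin n) → (toℕ (punchIn j x) <ᵇ toℕ j) ≡ (toℕ x <ᵇ toℕ j)
toℕ-punchIn-<ᵇ zero    x       = refl
toℕ-punchIn-<ᵇ (suc j) zero    = refl
toℕ-punchIn-<ᵇ (suc j) (suc x) = toℕ-punchIn-<ᵇ j x

count : ∀ {n} → (Fin n → Bool) → ℕ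
count {zero}  p = 0
count {suc n} p = if p zero then suc (count (p ∘ suc)) else count (p ∘ suc)

count≤n : ∀ {n} (p : Fin n → Bool) → count p ≤ n
count≤n {zero}  p = z≤n
count≤n {suc n} p with p zero
... | true  = s≤s (count≤n (p ∘ suc))
... | false = m≤n⇒m≤1+n (count≤n (p ∘ suc))

-- Where vertex 0 goes: to the front if it satisfies p, otherwise just behind
-- the block of the remaining vertices satisfying p.
partitionSlot : ∀ {n} (p : Fin (suc n) → Bool) → Fin (suc n)
partitionSlot p = if p zero then zero else fromℕ< (s≤s (count≤n (p ∘ suc)))

partitionPerm : ∀ {n} (p : Fin n → Bool) → Permutation n n
partitionPerm {zero}  p = Permutation.id
partitionPerm {suc n} p = insert zero (partitionSlot p) (partitionPerm (p ∘ suc))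

partitionPerm-<ᵇ : ∀ {n} (p : Fin n → Bool) i → (toℕ (partitionPerm p ⟨$⟩ʳ i) <ᵇ count p) ≡ p i
partitionPerm-<ᵇ {suc n} p zero with p zero
... | true  = refl
... | false = begin
  toℕ (fromℕ< (s≤s (count≤n (p ∘ suc)))) <ᵇ count (p ∘ suc) ≡⟨ cong (_<ᵇ count (p ∘ suc)) (toℕ-fromℕ< _) ⟩
  count (p ∘ suc) <ᵇ count (p ∘ suc)                           ≡⟨ n<ᵇn≡false (count (p ∘ suc)) ⟩
  false                                                        ∎
  where open ≡-Reasoning
partitionPerm-<ᵇ {suc n} p (suc k)
  rewrite insert-punchIn zero (partitionSlot p) (partitionPerm (p ∘ suc)) k with p zero
... | true  = partitionPerm-<ᵇ (p ∘ suc) k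
... | false = begin
  toℕ (punchIn slot σk) <ᵇ count (p ∘ suc) ≡⟨ cong (toℕ (punchIn slot σk) <ᵇ_) (≡-sym toℕ-slot) ⟩
  toℕ (punchIn slot σk) <ᵇ toℕ slot        ≡⟨ toℕ-punchIn-<ᵇ slot σk ⟩
  toℕ σk <ᵇ toℕ slot                       ≡⟨ cong (toℕ σk <ᵇ_) toℕ-slot ⟩
  toℕ σk <ᵇ count (p ∘ suc)                ≡⟨ partitionPerm-<ᵇ (p ∘ suc) k ⟩
  p (suc k)                                ∎
  where
  open ≡-Reasoning
  slot : Fin (suc n)
  slot = fromℕ< (s≤s (count≤n (p ∘ suc)))
  σk : Fin n
  σk = partitionPerm (p ∘ suc) ⟨$⟩ʳ k
  toℕ-slot : toℕ slot ≡ count (p ∘ suc)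
  toℕ-slot = toℕ-fromℕ< _

module _ {n : ℕ} (G : Graph n) where

  NonIsolated : Fin n → Set
  NonIsolated v = ∃ λ u → adj G v u ≡ true

  nonIsolated? : ∀ v → Dec (NonIsolated v)
  nonIsolated? v = any? (λ u → adj G v u ≟ᵇ true)

  nonIsolatedᵇ : Fin n → Bool
  nonIsolatedᵇ v = does (nonIsolated? v)

  NonIsolatedClique : Set
  NonIsolatedClique = ∀ {x y} → x ≢ y → NonIsolated x → NonIsolated y → adj G x y ≡ true

  adj-sym : ∀ {x y b} → adj G x y ≡ b → adj G y x ≡ b
  adj-sym {x} {y} xy = trans (sym G y x) xy

  adj⇒≢ : ∀ {x y} → adj G x y ≡ true → x ≢ y
  adj⇒≢ {x} xy refl with () ← trans (≡-sym xy) (irrefl G x)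

  adj⇒nonIsolated : ∀ {x y} → adj G x y ≡ true → NonIsolated y
  adj⇒nonIsolated {x} xy = x , adj-sym xy

  x∈N⁺ : ∀ {v x} → adj G v x ≡ true → x ∈ N G v
  x∈N⁺ {v} {x} vx = lookup⇒[]= x (N G v) (trans (lookup∘tabulate (adj G v) x) vx)

  x∈N⁻ : ∀ {v x} → x ∈ N G v → adj G v x ≡ true
  x∈N⁻ {v} {x} x∈N = trans (≡-sym (lookup∘tabulate (adj G v) x)) ([]=⇒lookup x∈N)

  -- Components and forts

  IsClique : Subset n → Set
  IsClique C = ∀ {x y} → x ∈ C → y ∈ C → x ≢ y → adj G x y ≡ true

  ⁅x⁆-isClique : ∀ {x} → IsClique ⁅ x ⁆
  ⁅x⁆-isClique {x} y∈ z∈ y≢z = ⊥-elim (y≢z (trans (x∈⁅y⁆⇒x≡y x y∈) (≡-sym (x∈⁅y⁆⇒x≡y x z∈))))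

  ⁅x⁆∪⁅y⁆-isClique : ∀ {x y} → adj G x y ≡ true → IsClique (⁅ x ⁆ ∪ ⁅ y ⁆)
  ⁅x⁆∪⁅y⁆-isClique xy u∈ v∈ u≢v with x∈⁅y⁆∪⁅z⁆⁻ u∈ | x∈⁅y⁆∪⁅z⁆⁻ v∈
  ... | inj₁ refl | inj₂ refl = xy
  ... | inj₂ refl | inj₁ refl = adj-sym xy
  ... | inj₁ refl | inj₁ refl = ⊥-elim (u≢v refl)
  ... | inj₂ refl | inj₂ refl = ⊥-elim (u≢v refl)

  clique⇒component : ∀ {F C} → Nonempty C → C ⊆ F → IsClique C
    → (∀ x y → x ∈ C → y ∈ F → adj G x y ≡ true → y ∈ C) → IsComponent G F C
  clique⇒component {C = C} nonempty C⊆F clique closed = nonempty , C⊆F , path , closed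
    where
    path : ∀ x y → x ∈ C → y ∈ C → Path G C x y
    path x y x∈C y∈C with x ≟ y
    ... | yes refl = here x∈C
    ... | no x≢y   = step x∈C (clique x∈C y∈C x≢y) (here y∈C)

  UniqueNeighbourIn : Subset n → Fin n → Fin n → Set
  UniqueNeighbourIn C v x = x ∈ C × adj G v x ≡ true × (∀ {y} → y ∈ C → adj G v y ≡ true → y ≡ x)

  fort⇒¬uniqueNeighbour : ∀ {C v x} → IsFort G C → v ∉ C → ¬ UniqueNeighbourIn C v x
  fort⇒¬uniqueNeighbour {C} {v} {x} (_ , fort) v∉C (x∈C , vx , unique) =
    fort v v∉C (trans (cong ∣_∣ C∩Nv≡⁅x⁆) (∣⁅x⁆∣≡1 x))
    where
    C∩Nv≡⁅x⁆ : C ∩ N G v ≡ ⁅ x ⁆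
    C∩Nv≡⁅x⁆ = p∩q≡⁅x⁆⁺ x∈C (x∈N⁺ vx) λ y∈C y∈N → unique y∈C (x∈N⁻ y∈N)

  ¬uniqueNeighbour⇒fort : ∀ {C} → Nonempty C → (∀ {v x} → v ∉ C → ¬ UniqueNeighbourIn C v x) → IsFort G C
  ¬uniqueNeighbour⇒fort {C} nonempty noUnique = nonempty , λ v v∉C ∣C∩Nv∣≡1 →
    let (x , x∈C∩Nv , unique) = ∣p∣≡1⇒unique ∣C∩Nv∣≡1
        (x∈C , x∈Nv) = x∈p∩q⁻ C (N G v) x∈C∩Nv
    in noUnique v∉C (x∈C , x∈N⁻ x∈Nv , λ y∈C vy → unique (x∈p∩q⁺ (y∈C , x∈N⁺ vy)))

  PSDFort⇒neighbourIn : ∀ {F u} → IsPSDFort G F → u ∈ F → NonIsolated u → ∃ λ y → y ∈ F × adj G u y ≡ true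
  PSDFort⇒neighbourIn {F} {u} (_ , forts) u∈F (b , ub)
    with any? (λ y → (y ∈? F) ×-dec (adj G u y ≟ᵇ true))
  ... | yes neighbour = neighbour
  ... | no noNeighbour = ⊥-elim (fort⇒¬uniqueNeighbour (forts ⁅ u ⁆ ⁅u⁆-component) b∉⁅u⁆
                           (x∈⁅x⁆ u , adj-sym ub , λ y∈⁅u⁆ _ → x∈⁅y⁆⇒x≡y u y∈⁅u⁆))
    where
    closed : ∀ x y → x ∈ ⁅ u ⁆ → y ∈ F → adj G x y ≡ true → y ∈ ⁅ u ⁆
    closed x y x∈⁅u⁆ y∈F xy with x∈⁅y⁆⇒x≡y u x∈⁅u⁆
    ... | refl = ⊥-elim (noNeighbour (y , y∈F , xy))
    ⁅u⁆-component : IsComponent G F ⁅ u ⁆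
    ⁅u⁆-component = clique⇒component (u , x∈⁅x⁆ u) (⁅x⁆⊆p u∈F) ⁅x⁆-isClique closed
    b∉⁅u⁆ : b ∉ ⁅ u ⁆
    b∉⁅u⁆ b∈⁅u⁆ = adj⇒≢ ub (≡-sym (x∈⁅y⁆⇒x≡y u b∈⁅u⁆))

  -- Under the clique condition a component of F meeting a non-isolated vertex contains all
  -- non-isolated vertices of F, and an outside neighbour of one of them sees all of them.
  partnered⇒PSDFort : NonIsolatedClique → ∀ {F} → Nonempty F
    → (∀ {u} → u ∈ F → NonIsolated u → ∃ λ z → z ∈ F × z ≢ u × NonIsolated z)
    → IsPSDFort G F
  partnered⇒PSDFort clique {F} nonempty partner = nonempty , component⇒fort
    where
    component⇒fort : ∀ C → IsComponent G F C → IsFort G C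
    component⇒fort C (nonemptyC , C⊆F , _ , closed) = ¬uniqueNeighbour⇒fort nonemptyC noUnique
      where
      noUnique : ∀ {v x} → v ∉ C → ¬ UniqueNeighbourIn C v x
      noUnique {v} {x} v∉C (x∈C , vx , unique) with partner (C⊆F x∈C) (adj⇒nonIsolated vx)
      ... | z , z∈F , z≢x , nz = z≢x (unique z∈C (clique v≢z (x , vx) nz))
        where
        z∈C : z ∈ C
        z∈C = closed x z x∈C z∈F (clique (z≢x ∘ ≡-sym) (adj⇒nonIsolated vx) nz)
        v≢z : v ≢ z
        v≢z refl = v∉C z∈C

  -- Z₊-irredundant sets

  Z+Ir⇒neighbourOutside : ∀ {S u} → IsZ+IrSet G S → u ∈ S → NonIsolated u → ∃ λ z → z ∉ S × adj G u z ≡ true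
  Z+Ir⇒neighbourOutside {S} {u} irredundant u∈S nu with irredundant u u∈S
  ... | F , fort , S∩F≡⁅u⁆ with PSDFort⇒neighbourIn fort (p∩q≡⁅x⁆⇒x∈q S∩F≡⁅u⁆) nu
  ...   | y , y∈F , uy = y , (λ y∈S → adj⇒≢ uy (≡-sym (p∩q≡⁅x⁆⇒≡x S∩F≡⁅u⁆ y∈S y∈F))) , uy

  Z+Ir⇒≢⊤ : ∀ {S a} → NonIsolated a → IsZ+IrSet G S → S ≢ ⊤
  Z+Ir⇒≢⊤ na irredundant refl = proj₁ (proj₂ (Z+Ir⇒neighbourOutside irredundant ∈⊤ na)) ∈⊤

  nonIsolatedOutside⇒Z+Ir : NonIsolatedClique → ∀ {S}
    → (∀ {u} → u ∈ S → NonIsolated u → ∃ λ z → z ∉ S × NonIsolated z) → IsZ+IrSet G S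
  nonIsolatedOutside⇒Z+Ir clique {S} outside u u∈S with nonIsolated? u
  ... | no ¬nu = ⁅ u ⁆ , partnered⇒PSDFort clique (u , x∈⁅x⁆ u) noPartnerNeeded ,
                 p∩q≡⁅x⁆⁺ u∈S (x∈⁅x⁆ u) (λ _ y∈⁅u⁆ → x∈⁅y⁆⇒x≡y u y∈⁅u⁆)
    where
    noPartnerNeeded : ∀ {u'} → u' ∈ ⁅ u ⁆ → NonIsolated u' → ∃ λ z → z ∈ ⁅ u ⁆ × z ≢ u' × NonIsolated z
    noPartnerNeeded u'∈⁅u⁆ nu' with x∈⁅y⁆⇒x≡y u u'∈⁅u⁆
    ... | refl = ⊥-elim (¬nu nu')
  ... | yes nu with outside u∈S nu
  ...   | z , z∉S , nz = ⁅ u ⁆ ∪ ⁅ z ⁆ , partnered⇒PSDFort clique (u , u∈pair) partner ,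
                         p∩q≡⁅x⁆⁺ u∈S u∈pair onlyU
    where
    u∈pair : u ∈ ⁅ u ⁆ ∪ ⁅ z ⁆
    u∈pair = x∈⁅y⁆∪⁅z⁆⁺ (inj₁ refl)
    z≢u : z ≢ u
    z≢u refl = z∉S u∈S
    partner : ∀ {u'} → u' ∈ ⁅ u ⁆ ∪ ⁅ z ⁆ → NonIsolated u' → ∃ λ y → y ∈ ⁅ u ⁆ ∪ ⁅ z ⁆ × y ≢ u' × NonIsolated y
    partner u'∈pair _ with x∈⁅y⁆∪⁅z⁆⁻ u'∈pair
    ... | inj₁ refl = z , x∈⁅y⁆∪⁅z⁆⁺ (inj₂ refl) , z≢u , nz
    ... | inj₂ refl = u , u∈pair , z≢u ∘ ≡-sym , nu
    onlyU : ∀ {y} → y ∈ S → y ∈ ⁅ u ⁆ ∪ ⁅ z ⁆ → y ≡ u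
    onlyU y∈S y∈pair with x∈⁅y⁆∪⁅z⁆⁻ y∈pair
    ... | inj₁ y≡u  = y≡u
    ... | inj₂ refl = ⊥-elim (z∉S y∈S)

  nonIsolated∉⇒Z+Ir : NonIsolatedClique → ∀ {S z} → z ∉ S → NonIsolated z → IsZ+IrSet G S
  nonIsolated∉⇒Z+Ir clique z∉S nz = nonIsolatedOutside⇒Z+Ir clique λ _ _ → _ , z∉S , nz

  Z+Ir-∪-isolated : NonIsolatedClique → ∀ {S v} → IsZ+IrSet G S → ¬ NonIsolated v → IsZ+IrSet G (S ∪ ⁅ v ⁆)
  Z+Ir-∪-isolated clique {S} {v} irredundant ¬nv = nonIsolatedOutside⇒Z+Ir clique outside
    where
    outside : ∀ {u} → u ∈ S ∪ ⁅ v ⁆ → NonIsolated u → ∃ λ z → z ∉ S ∪ ⁅ v ⁆ × NonIsolated z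
    outside {u} u∈S∪⁅v⁆ nu with x∈p∪q⁻ S ⁅ v ⁆ u∈S∪⁅v⁆
    ... | inj₂ u∈⁅v⁆ = ⊥-elim (¬nv (subst NonIsolated (x∈⁅y⁆⇒x≡y v u∈⁅v⁆) nu))
    ... | inj₁ u∈S with Z+Ir⇒neighbourOutside irredundant u∈S nu
    ...   | z , z∉S , uz = z , x∉p∪⁅y⁆ z∉S z≢v , adj⇒nonIsolated uz
      where
      z≢v : z ≢ v
      z≢v refl = ¬nv (adj⇒nonIsolated uz)

  -- Of two vertices x ≢ y outside S, add x if y is non-isolated and y otherwise.
  maximalZ+Ir⇒atMostOneOutside : NonIsolatedClique → ∀ {S} → IsMaximalZ+IrSet G S → AtMostOneOutside S
  maximalZ+Ir⇒atMostOneOutside clique {S} (irredundant , maximal) {x} {y} x∉S y∉S with x ≟ y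
  ... | yes x≡y = x≡y
  ... | no x≢y with nonIsolated? y
  ...   | yes ny = ⊥-elim (maximal (S ∪ ⁅ x ⁆) (p⊂p∪⁅x⁆ x∉S)
                     (nonIsolated∉⇒Z+Ir clique (x∉p∪⁅y⁆ y∉S (x≢y ∘ ≡-sym)) ny))
  ...   | no ¬ny = ⊥-elim (maximal (S ∪ ⁅ y ⁆) (p⊂p∪⁅x⁆ y∉S) (Z+Ir-∪-isolated clique irredundant ¬ny))

  pairFort⇒neighbourOfBoth : ∀ {u w v} → IsFort G (⁅ u ⁆ ∪ ⁅ w ⁆) → v ∉ ⁅ u ⁆ ∪ ⁅ w ⁆
    → adj G v u ≡ true → adj G v w ≡ true
  pairFort⇒neighbourOfBoth {u} {w} {v} fort v∉pair vu = ¬-not λ vw →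
    fort⇒¬uniqueNeighbour fort v∉pair (x∈⁅y⁆∪⁅z⁆⁺ (inj₁ refl) , vu , onlyU vw)
    where
    onlyU : adj G v w ≡ false → ∀ {y} → y ∈ ⁅ u ⁆ ∪ ⁅ w ⁆ → adj G v y ≡ true → y ≡ u
    onlyU vw y∈pair vy with x∈⁅y⁆∪⁅z⁆⁻ y∈pair
    ... | inj₁ y≡u  = y≡u
    ... | inj₂ refl with () ← trans (≡-sym vy) vw

  pairFort⇒twins : ∀ {u w v} → IsFort G (⁅ u ⁆ ∪ ⁅ w ⁆) → v ≢ u → v ≢ w → adj G v u ≡ adj G v w
  pairFort⇒twins {u} {w} {v} fort v≢u v≢w = x≡true⇔y≡true⇒x≡y
    (pairFort⇒neighbourOfBoth fort v∉pair)
    (pairFort⇒neighbourOfBoth (subst (IsFort G) (∪-comm ⁅ u ⁆ ⁅ w ⁆) fort) (v∉pair ∘ subst (v ∈_) (∪-comm ⁅ w ⁆ ⁅ u ⁆)))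
    where
    v∉pair : v ∉ ⁅ u ⁆ ∪ ⁅ w ⁆
    v∉pair v∈pair = [ v≢u , v≢w ]′ (x∈⁅y⁆∪⁅z⁆⁻ v∈pair)

  -- The PSD fort isolating u in S can only use u and w, so it is exactly {u, w}.
  oneOutsideZ+Ir⇒twin : ∀ {S w} → IsZ+IrSet G S → (∀ {z} → z ∉ S → z ≡ w) → ∀ {u} → u ≢ w → NonIsolated u
    → adj G u w ≡ true × (∀ {v} → v ≢ u → v ≢ w → adj G v u ≡ adj G v w)
  oneOutsideZ+Ir⇒twin {S} {w} irredundant outside {u} u≢w nu with irredundant u (¬∉⇒∈ (u≢w ∘ outside))
  ... | F , fort , S∩F≡⁅u⁆ = uw , λ v≢u v≢w → pairFort⇒twins (proj₂ fort _ pair-component) v≢u v≢w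
    where
    u∈F : u ∈ F
    u∈F = p∩q≡⁅x⁆⇒x∈q S∩F≡⁅u⁆
    inF⇒u-or-w : ∀ {x} → x ∈ F → x ≡ u ⊎ x ≡ w
    inF⇒u-or-w {x} x∈F with x ∈? S
    ... | yes x∈S = inj₁ (p∩q≡⁅x⁆⇒≡x S∩F≡⁅u⁆ x∈S x∈F)
    ... | no x∉S  = inj₂ (outside x∉S)
    w-neighbourInF : w ∈ F × adj G u w ≡ true
    w-neighbourInF with PSDFort⇒neighbourIn fort u∈F nu
    ... | y , y∈F , uy with inF⇒u-or-w y∈F
    ...   | inj₁ refl = ⊥-elim (adj⇒≢ uy refl)
    ...   | inj₂ refl = y∈F , uy
    uw : adj G u w ≡ true
    uw = proj₂ w-neighbourInF
    pair⊆F : ⁅ u ⁆ ∪ ⁅ w ⁆ ⊆ F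
    pair⊆F x∈pair with x∈⁅y⁆∪⁅z⁆⁻ x∈pair
    ... | inj₁ refl = u∈F
    ... | inj₂ refl = proj₁ w-neighbourInF
    pair-component : IsComponent G F (⁅ u ⁆ ∪ ⁅ w ⁆)
    pair-component = clique⇒component (u , x∈⁅y⁆∪⁅z⁆⁺ (inj₁ refl)) pair⊆F (⁅x⁆∪⁅y⁆-isClique uw)
                       λ _ _ _ y∈F _ → x∈⁅y⁆∪⁅z⁆⁺ (inF⇒u-or-w y∈F)

  oneOutsideZ+Ir⇒clique : ∀ {S w} → IsZ+IrSet G S → (∀ {z} → z ∉ S → z ≡ w) → NonIsolatedClique
  oneOutsideZ+Ir⇒clique {S} {w} irredundant outside {x} {y} x≢y nx ny = adjacent (x ≟ w) (y ≟ w)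
    where
    twin : ∀ {u} → u ≢ w → NonIsolated u → adj G u w ≡ true × (∀ {v} → v ≢ u → v ≢ w → adj G v u ≡ adj G v w)
    twin = oneOutsideZ+Ir⇒twin irredundant outside
    adjacent : Dec (x ≡ w) → Dec (y ≡ w) → adj G x y ≡ true
    adjacent (yes refl) (yes refl) = ⊥-elim (x≢y refl)
    adjacent (yes refl) (no y≢w)   = adj-sym (proj₁ (twin y≢w ny))
    adjacent (no x≢w)   (yes refl) = proj₁ (twin x≢w nx)
    adjacent (no x≢w)   (no y≢w)   = adj-sym (trans (proj₂ (twin x≢w nx) (x≢y ∘ ≡-sym) y≢w) (proj₁ (twin y≢w ny)))

  -- PSD forcing

  PSDReach⇒⊆ : ∀ {S B} → PSDReach G S B → S ⊆ B
  PSDReach⇒⊆ start         x∈S = x∈S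
  PSDReach⇒⊆ (force reach _) x∈S = p⊆p∪q _ (PSDReach⇒⊆ reach x∈S)

  NoWhiteNeighbour : Subset n → Fin n → Set
  NoWhiteNeighbour B w = ∀ {z} → z ∉ B → adj G w z ≡ false

  noWhiteNeighbour⇒force : ∀ {B u w} → u ∈ B → w ∉ B → adj G u w ≡ true → NoWhiteNeighbour B w → PSDForce G B u w
  noWhiteNeighbour⇒force {B} {u} {w} u∈B w∉B uw noWhite =
    u∈B , w∉B , uw , ⁅ w ⁆ , ⁅w⁆-component , x∈⁅x⁆ w , λ _ w'∈⁅w⁆ _ → x∈⁅y⁆⇒x≡y w w'∈⁅w⁆
    where
    closed : ∀ x y → x ∈ ⁅ w ⁆ → y ∈ ∁ B → adj G x y ≡ true → y ∈ ⁅ w ⁆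
    closed x y x∈⁅w⁆ y∈∁B xy with x∈⁅y⁆⇒x≡y w x∈⁅w⁆
    ... | refl with () ← trans (≡-sym xy) (noWhite (x∈∁p⇒x∉p y∈∁B))
    ⁅w⁆-component : IsComponent G (∁ B) ⁅ w ⁆
    ⁅w⁆-component = clique⇒component (w , x∈⁅x⁆ w) (⁅x⁆⊆p (x∉p⇒x∈∁p w∉B)) ⁅x⁆-isClique closed

  whitePair⇒force : ∀ {B u w x} → (∀ {z} → z ∉ B → z ≡ w ⊎ z ≡ x) → w ∉ B → x ∉ B → adj G w x ≡ true
    → u ∈ B → adj G u w ≡ true → adj G u x ≡ false → PSDForce G B u w
  whitePair⇒force {B} {u} {w} {x} white w∉B x∉B wx u∈B uw ux =
    u∈B , w∉B , uw , ⁅ w ⁆ ∪ ⁅ x ⁆ , pair-component , x∈⁅y⁆∪⁅z⁆⁺ (inj₁ refl) , onlyW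
    where
    pair⊆∁B : ⁅ w ⁆ ∪ ⁅ x ⁆ ⊆ ∁ B
    pair⊆∁B y∈pair with x∈⁅y⁆∪⁅z⁆⁻ y∈pair
    ... | inj₁ refl = x∉p⇒x∈∁p w∉B
    ... | inj₂ refl = x∉p⇒x∈∁p x∉B
    pair-component : IsComponent G (∁ B) (⁅ w ⁆ ∪ ⁅ x ⁆)
    pair-component = clique⇒component (w , x∈⁅y⁆∪⁅z⁆⁺ (inj₁ refl)) pair⊆∁B (⁅x⁆∪⁅y⁆-isClique wx)
                       λ _ _ _ y∈∁B _ → x∈⁅y⁆∪⁅z⁆⁺ (white (x∈∁p⇒x∉p y∈∁B))
    onlyW : ∀ w' → w' ∈ ⁅ w ⁆ ∪ ⁅ x ⁆ → adj G u w' ≡ true → w' ≡ w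
    onlyW w' w'∈pair uw' with x∈⁅y⁆∪⁅z⁆⁻ w'∈pair
    ... | inj₁ w'≡w = w'≡w
    ... | inj₂ refl with () ← trans (≡-sym uw') ux

  stalled⇒¬noWhiteNeighbour : ∀ {B w} → Stalled G B → w ∉ B → NonIsolated w → ¬ NoWhiteNeighbour B w
  stalled⇒¬noWhiteNeighbour {B} {w} stalled w∉B (u , wu) noWhite with u ∈? B
  ... | yes u∈B = stalled u w (noWhiteNeighbour⇒force u∈B w∉B (adj-sym wu) noWhite)
  ... | no u∉B with () ← trans (≡-sym wu) (noWhite u∉B)

  independentComplement⇒forcing : ∀ {S} → (∀ {z} → z ∉ S → NonIsolated z)
    → (∀ {z z'} → z ∉ S → z' ∉ S → adj G z z' ≡ false) → IsPSDForcingSet G S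
  independentComplement⇒forcing {S} nonIsolated independent B reach stalled = ∀∈⇒≡⊤ λ z → ¬∉⇒∈ λ z∉B →
    stalled⇒¬noWhiteNeighbour stalled z∉B (nonIsolated (∉B⇒∉S z∉B)) λ z'∉B → independent (∉B⇒∉S z∉B) (∉B⇒∉S z'∉B)
    where
    ∉B⇒∉S : ∀ {z} → z ∉ B → z ∉ S
    ∉B⇒∉S z∉B z∈S = z∉B (PSDReach⇒⊆ reach z∈S)

  ∁⁅x⁆-isPSDForcing : ∀ {x} → NonIsolated x → IsPSDForcingSet G (∁ ⁅ x ⁆)
  ∁⁅x⁆-isPSDForcing {x} nx = independentComplement⇒forcing (λ z∉ → subst NonIsolated (≡-sym (≡x z∉)) nx)
    λ z∉ z'∉ → subst₂ (λ z z' → adj G z z' ≡ false) (≡-sym (≡x z∉)) (≡-sym (≡x z'∉)) (irrefl G x)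
    where
    ≡x : ∀ {z} → z ∉ ∁ ⁅ x ⁆ → z ≡ x
    ≡x = x∈⁅y⁆⇒x≡y x ∘ x∉∁p⇒x∈p

  ∁⁅x⁆∪⁅y⁆-isPSDForcing : ∀ {x y} → NonIsolated x → NonIsolated y → adj G x y ≡ false
    → IsPSDForcingSet G (∁ (⁅ x ⁆ ∪ ⁅ y ⁆))
  ∁⁅x⁆∪⁅y⁆-isPSDForcing {x} {y} nx ny xy = independentComplement⇒forcing nonIsolated independent
    where
    nonIsolated : ∀ {z} → z ∉ ∁ (⁅ x ⁆ ∪ ⁅ y ⁆) → NonIsolated z
    nonIsolated z∉ with x∉∁⁅y⁆∪⁅z⁆ z∉
    ... | inj₁ refl = nx
    ... | inj₂ refl = ny
    independent : ∀ {z z'} → z ∉ ∁ (⁅ x ⁆ ∪ ⁅ y ⁆) → z' ∉ ∁ (⁅ x ⁆ ∪ ⁅ y ⁆) → adj G z z' ≡ false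
    independent z∉ z'∉ with x∉∁⁅y⁆∪⁅z⁆ z∉ | x∉∁⁅y⁆∪⁅z⁆ z'∉
    ... | inj₁ refl | inj₁ refl = irrefl G x
    ... | inj₁ refl | inj₂ refl = xy
    ... | inj₂ refl | inj₁ refl = adj-sym xy
    ... | inj₂ refl | inj₂ refl = irrefl G y

  -- y (blue, adjacent to w but not x) forces w unless w already has no white neighbour; then x follows.
  commonNeighbour⇒∁⁅w⁆∪⁅x⁆-isPSDForcing : ∀ {w x y} → adj G x w ≡ true → adj G y w ≡ true → adj G y x ≡ false
    → y ≢ x → IsPSDForcingSet G (∁ (⁅ w ⁆ ∪ ⁅ x ⁆))
  commonNeighbour⇒∁⁅w⁆∪⁅x⁆-isPSDForcing {w} {x} {y} xw yw yx y≢x B reach stalled =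
    ∀∈⇒≡⊤ λ z → ¬∉⇒∈ λ z∉B → [ (λ { refl → z∉B w∈B }) , (λ { refl → z∉B x∈B }) ]′ (white z∉B)
    where
    white : ∀ {z} → z ∉ B → z ≡ w ⊎ z ≡ x
    white z∉B = x∉∁⁅y⁆∪⁅z⁆ λ z∈ → z∉B (PSDReach⇒⊆ reach z∈)
    y∈B : y ∈ B
    y∈B = ¬∉⇒∈ λ y∉B → [ adj⇒≢ yw , y≢x ]′ (white y∉B)
    w∈B : w ∈ B
    w∈B = ¬∉⇒∈ λ w∉B → whiteW w∉B (x ∈? B)
      where
      whiteW : w ∉ B → Dec (x ∈ B) → ⊥
      whiteW w∉B (yes x∈B) = stalled⇒¬noWhiteNeighbour stalled w∉B (adj⇒nonIsolated xw) noWhite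
        where
        noWhite : NoWhiteNeighbour B w
        noWhite z∉B with white z∉B
        ... | inj₁ refl = irrefl G w
        ... | inj₂ refl = ⊥-elim (z∉B x∈B)
      whiteW w∉B (no x∉B) = stalled y w (whitePair⇒force white w∉B x∉B (adj-sym xw) y∈B yw yx)
    x∈B : x ∈ B
    x∈B = ¬∉⇒∈ λ x∉B → stalled⇒¬noWhiteNeighbour stalled x∉B (w , xw) noWhite
      where
      noWhite : NoWhiteNeighbour B x
      noWhite z∉B with white z∉B
      ... | inj₁ refl = ⊥-elim (z∉B w∈B)
      ... | inj₂ refl = irrefl G x

  nonIsolatedWhiteFree⇒stalled : ∀ {B} → (∀ {z} → z ∉ B → ¬ NonIsolated z) → Stalled G B
  nonIsolatedWhiteFree⇒stalled noNonIsolated u w (_ , w∉B , uw , _) = noNonIsolated w∉B (adj⇒nonIsolated uw)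

  -- If u forced w, a white non-isolated q ≢ w would be adjacent to both u and w, hence a second
  -- white neighbour of u in the component of w.
  twoNonIsolatedWhite⇒stalled : NonIsolatedClique → ∀ {B k k'} → k ≢ k' → k ∉ B → k' ∉ B
    → NonIsolated k → NonIsolated k' → Stalled G B
  twoNonIsolatedWhite⇒stalled clique {B} {k} {k'} k≢k' k∉B k'∉B nk nk' u w
    (u∈B , w∉B , uw , W , (_ , _ , _ , closed) , w∈W , onlyW) = secondNeighbour other
    where
    other : ∃ λ q → q ∉ B × NonIsolated q × q ≢ w
    other with k ≟ w
    ... | yes refl = k' , k'∉B , nk' , k≢k' ∘ ≡-sym
    ... | no k≢w   = k , k∉B , nk , k≢w
    secondNeighbour : (∃ λ q → q ∉ B × NonIsolated q × q ≢ w) → ⊥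
    secondNeighbour (q , q∉B , nq , q≢w) = q≢w (onlyW q q∈W (clique u≢q (w , uw) nq))
      where
      q∈W : q ∈ W
      q∈W = closed w q w∈W (x∉p⇒x∈∁p q∉B) (clique (q≢w ∘ ≡-sym) (adj⇒nonIsolated uw) nq)
      u≢q : u ≢ q
      u≢q refl = q∉B u∈B

  soleNonIsolatedWhite⇒closure : ∀ {S k} → k ∉ S → NonIsolated k → (∀ {z} → z ∉ S → NonIsolated z → z ≡ k)
    → PSDReach G S (S ∪ ⁅ k ⁆) × Stalled G (S ∪ ⁅ k ⁆)
  soleNonIsolatedWhite⇒closure {S} {k} k∉S (u , ku) sole =
    force start (noWhiteNeighbour⇒force u∈S k∉S (adj-sym ku) noWhite) ,
    nonIsolatedWhiteFree⇒stalled λ z∉ nz → z∉ (x∈p∪q⁺ (inj₂ (subst (_∈ ⁅ k ⁆) (≡-sym (sole (z∉ ∘ p⊆p∪q _) nz)) (x∈⁅x⁆ k))))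
    where
    u∈S : u ∈ S
    u∈S = ¬∉⇒∈ λ u∉S → adj⇒≢ ku (≡-sym (sole u∉S (adj⇒nonIsolated ku)))
    noWhite : NoWhiteNeighbour S k
    noWhite {z} z∉S with adj G k z in kz
    ... | false = refl
    ... | true  = ⊥-elim (adj⇒≢ kz (≡-sym (sole z∉S (adj⇒nonIsolated kz))))

  -- If S misses a vertex, S is stalled unless exactly one white vertex k is non-isolated,
  -- and then S ∪ {k} is reached and stalled, so it is everything.
  clique⇒forcing⇒atMostOneOutside : NonIsolatedClique → ∀ {S} → IsPSDForcingSet G S → AtMostOneOutside S
  clique⇒forcing⇒atMostOneOutside clique {S} forcing {w₁} {w₂} w₁∉S w₂∉S
    with any? (λ k → ¬? (k ∈? S) ×-dec nonIsolated? k)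
  ... | no none = ⊥-elim (w₁∉S (p≡⊤⇒x∈p (forcing S start (nonIsolatedWhiteFree⇒stalled λ z∉S nz → none (_ , z∉S , nz)))))
  ... | yes (k , k∉S , nk) with any? (λ k' → ¬? (k' ∈? S) ×-dec nonIsolated? k' ×-dec ¬? (k' ≟ k))
  ...   | yes (k' , k'∉S , nk' , k'≢k) =
    ⊥-elim (w₁∉S (p≡⊤⇒x∈p (forcing S start (twoNonIsolatedWhite⇒stalled clique k'≢k k'∉S k∉S nk' nk))))
  ...   | no noOther = trans (≡k w₁∉S) (≡-sym (≡k w₂∉S))
    where
    sole : ∀ {z} → z ∉ S → NonIsolated z → z ≡ k
    sole z∉S nz = decidable-stable (_ ≟ k) λ z≢k → noOther (_ , z∉S , nz , z≢k)
    closure : PSDReach G S (S ∪ ⁅ k ⁆) × Stalled G (S ∪ ⁅ k ⁆)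
    closure = soleNonIsolatedWhite⇒closure k∉S nk sole
    ≡k : ∀ {z} → z ∉ S → z ≡ k
    ≡k z∉S = x∈p∪⁅y⁆⇒x≡y (p≡⊤⇒x∈p (forcing _ (proj₁ closure) (proj₂ closure))) z∉S

  oneOutsideMinimalForcing⇒clique : ∀ {S w} → IsMinimalPSDForcingSet G S → w ∉ S → (∀ {z} → z ∉ S → z ≡ w)
    → NonIsolatedClique
  oneOutsideMinimalForcing⇒clique {S} {w} (forcing , minimal) w∉S outside {x} {y} x≢y nx ny =
    ¬-not λ xy → refute xy (x ≟ w) (y ≟ w)
    where
    inS : ∀ {z} → z ≢ w → z ∈ S
    inS z≢w = ¬∉⇒∈ (z≢w ∘ outside)
    nw : NonIsolated w
    nw = decidable-stable (nonIsolated? w) λ ¬nw →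
      w∉S (p≡⊤⇒x∈p (forcing S start (nonIsolatedWhiteFree⇒stalled λ z∉S nz → ¬nw (subst NonIsolated (outside z∉S) nz))))
    smaller : ∀ {c} → c ∈ S → ∁ (⁅ w ⁆ ∪ ⁅ c ⁆) ⊂ S
    smaller {c} c∈S =
      (λ z∈ → ¬∉⇒∈ λ z∉S → x∈∁p⇒x∉p z∈ (x∈⁅y⁆∪⁅z⁆⁺ (inj₁ (outside z∉S)))) ,
      c , c∈S , x∈p⇒x∉∁p (x∈⁅y⁆∪⁅z⁆⁺ (inj₂ refl))
    notForcing : ∀ {c} → c ≢ w → ¬ IsPSDForcingSet G (∁ (⁅ w ⁆ ∪ ⁅ c ⁆))
    notForcing c≢w = minimal _ (smaller (inS c≢w))
    refute : adj G x y ≡ false → Dec (x ≡ w) → Dec (y ≡ w) → ⊥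
    refute xy (yes refl) _          = notForcing (x≢y ∘ ≡-sym) (∁⁅x⁆∪⁅y⁆-isPSDForcing nx ny xy)
    refute xy (no x≢w)   (yes refl) = notForcing x≢y (∁⁅x⁆∪⁅y⁆-isPSDForcing ny nx (adj-sym xy))
    refute xy (no x≢w)   (no y≢w)   with adj G x w in xw | adj G y w in yw
    ... | false | _     = notForcing x≢w (∁⁅x⁆∪⁅y⁆-isPSDForcing nw nx (adj-sym xw))
    ... | true  | false = notForcing y≢w (∁⁅x⁆∪⁅y⁆-isPSDForcing nw ny (adj-sym yw))
    ... | true  | true  = notForcing x≢w (commonNeighbour⇒∁⁅w⁆∪⁅x⁆-isPSDForcing xw yw (adj-sym xy) (x≢y ∘ ≡-sym))

  clique⇒Zplus≡n∸1 : ∀ {a} → NonIsolated a → NonIsolatedClique → Zplus≡ G (n ∸ 1)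
  clique⇒Zplus≡n∸1 {a} na clique = (∁ ⁅ a ⁆ , ∁⁅x⁆-isPSDForcing na , ∣∁⁅x⁆∣≡n∸1 a) ,
    λ _ forcing → atMostOneOutside⇒n∸1≤∣p∣ (clique⇒forcing⇒atMostOneOutside clique forcing)

  Zplus≡n∸1⇒clique : Zplus≡ G (n ∸ 1) → NonIsolatedClique
  Zplus≡n∸1⇒clique (_ , minimum) {x} {y} x≢y nx ny = ¬-not λ xy →
    <⇒≱ (twoOutside⇒∣p∣<n∸1 x≢y (x∈p⇒x∉∁p (x∈⁅y⁆∪⁅z⁆⁺ (inj₁ refl))) (x∈p⇒x∉∁p (x∈⁅y⁆∪⁅z⁆⁺ (inj₂ refl))))
        (minimum _ (∁⁅x⁆∪⁅y⁆-isPSDForcing nx ny xy))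

  clique⇒ZplusBar≡n∸1 : ∀ {a} → NonIsolated a → NonIsolatedClique → ZplusBar≡ G (n ∸ 1)
  clique⇒ZplusBar≡n∸1 {a} na clique = (∁ ⁅ a ⁆ , (∁⁅x⁆-isPSDForcing na , minimal) , ∣∁⁅x⁆∣≡n∸1 a) ,
    λ S minimalS → p≢⊤⇒∣p∣≤n∸1 (≢⊤ minimalS)
    where
    minimal : ∀ T → T ⊂ ∁ ⁅ a ⁆ → ¬ IsPSDForcingSet G T
    minimal T (T⊆∁⁅a⁆ , x , x∈∁⁅a⁆ , x∉T) forcing =
      x∈∁p⇒x∉p x∈∁⁅a⁆ (subst (_∈ ⁅ a ⁆) (clique⇒forcing⇒atMostOneOutside clique forcing a∉T x∉T) (x∈⁅x⁆ a))
      where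
      a∉T : a ∉ T
      a∉T a∈T = x∈∁p⇒x∉p (T⊆∁⁅a⁆ a∈T) (x∈⁅x⁆ a)
    ≢⊤ : ∀ {S} → IsMinimalPSDForcingSet G S → S ≢ ⊤
    ≢⊤ (_ , minimalS) refl = minimalS (∁ ⁅ a ⁆) ((λ _ → ∈⊤) , a , ∈⊤ , x∈p⇒x∉∁p (x∈⁅x⁆ a)) (∁⁅x⁆-isPSDForcing na)

  ZplusBar≡n∸1⇒clique : 0 < n → ZplusBar≡ G (n ∸ 1) → NonIsolatedClique
  ZplusBar≡n∸1⇒clique 0<n ((S , minimalS , ∣S∣≡n∸1) , _) with ∣p∣≡n∸1⇒oneOutside 0<n ∣S∣≡n∸1
  ... | w , w∉S , outside = oneOutsideMinimalForcing⇒clique minimalS w∉S outside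

  clique⇒z+ir≡n∸1 : ∀ {a} → NonIsolated a → NonIsolatedClique → z+ir≡ G (n ∸ 1)
  clique⇒z+ir≡n∸1 {a} na clique = (∁ ⁅ a ⁆ , (irredundant , maximal) , ∣∁⁅x⁆∣≡n∸1 a) ,
    λ _ maximalS → atMostOneOutside⇒n∸1≤∣p∣ (maximalZ+Ir⇒atMostOneOutside clique maximalS)
    where
    irredundant : IsZ+IrSet G (∁ ⁅ a ⁆)
    irredundant = nonIsolated∉⇒Z+Ir clique (x∈p⇒x∉∁p (x∈⁅x⁆ a)) na
    maximal : ∀ T → ∁ ⁅ a ⁆ ⊂ T → ¬ IsZ+IrSet G T
    maximal T ∁⁅a⁆⊂T irredundantT = Z+Ir⇒≢⊤ na irredundantT (∁⁅x⁆⊂p⇒p≡⊤ ∁⁅a⁆⊂T)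

  clique⇒Z+IR≡n∸1 : ∀ {a} → NonIsolated a → NonIsolatedClique → Z+IR≡ G (n ∸ 1)
  clique⇒Z+IR≡n∸1 {a} na clique =
    (∁ ⁅ a ⁆ , nonIsolated∉⇒Z+Ir clique (x∈p⇒x∉∁p (x∈⁅x⁆ a)) na , ∣∁⁅x⁆∣≡n∸1 a) ,
    λ _ irredundant → p≢⊤⇒∣p∣≤n∸1 (Z+Ir⇒≢⊤ na irredundant)

  ∣S∣≡n∸1-Z+Ir⇒clique : ∀ {S} → 0 < n → IsZ+IrSet G S → ∣ S ∣ ≡ n ∸ 1 → NonIsolatedClique
  ∣S∣≡n∸1-Z+Ir⇒clique 0<n irredundant ∣S∣≡n∸1 with ∣p∣≡n∸1⇒oneOutside 0<n ∣S∣≡n∸1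
  ... | _ , _ , outside = oneOutsideZ+Ir⇒clique irredundant outside

  z+ir≡n∸1⇒clique : 0 < n → z+ir≡ G (n ∸ 1) → NonIsolatedClique
  z+ir≡n∸1⇒clique 0<n ((_ , (irredundant , _) , ∣S∣≡n∸1) , _) = ∣S∣≡n∸1-Z+Ir⇒clique 0<n irredundant ∣S∣≡n∸1

  Z+IR≡n∸1⇒clique : 0 < n → Z+IR≡ G (n ∸ 1) → NonIsolatedClique
  Z+IR≡n∸1⇒clique 0<n ((_ , irredundant , ∣S∣≡n∸1) , _) = ∣S∣≡n∸1-Z+Ir⇒clique 0<n irredundant ∣S∣≡n∸1

  -- Isomorphism with K_m ⊔ (n − m)K₁

  nonIsolated⇒<count : ∀ {v} → NonIsolated v → toℕ (partitionPerm nonIsolatedᵇ ⟨$⟩ʳ v) < count nonIsolatedᵇ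
  nonIsolated⇒<count {v} nv =
    <ᵇ⇒< _ _ (Equivalence.from T-≡ (trans (partitionPerm-<ᵇ nonIsolatedᵇ v) (dec-true (nonIsolated? v) nv)))

  HasEdge⇒2≤count : HasEdge G → 2 ≤ count nonIsolatedᵇ
  HasEdge⇒2≤count (a , b , ab) = distinct-<⇒2≤ (nonIsolated⇒<count (b , ab)) (nonIsolated⇒<count (adj⇒nonIsolated ab))
    (adj⇒≢ ab ∘ Injection.injective (↔⇒↣ (partitionPerm nonIsolatedᵇ)) ∘ toℕ-injective)

  clique⇒adj≡nonIsolatedᵇ∧nonIsolatedᵇ : NonIsolatedClique → ∀ {i j} → i ≢ j
    → adj G i j ≡ (nonIsolatedᵇ i ∧ nonIsolatedᵇ j)
  clique⇒adj≡nonIsolatedᵇ∧nonIsolatedᵇ clique {i} {j} i≢j with adj G i j in ij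
  ... | true rewrite dec-true (nonIsolated? i) (j , ij) | dec-true (nonIsolated? j) (adj⇒nonIsolated ij) = refl
  ... | false with nonIsolated? i | nonIsolated? j
  ...   | yes ni | yes nj with () ← trans (≡-sym (clique i≢j ni nj)) ij
  ...   | yes _  | no _  = refl
  ...   | no _   | _     = refl

  clique⇒≅KplusIsolated : NonIsolatedClique → G ≅ KplusIsolated n (count nonIsolatedᵇ)
  clique⇒≅KplusIsolated clique = σ , adj≡
    where
    σ : Permutation n n
    σ = partitionPerm nonIsolatedᵇ
    m : ℕ
    m = count nonIsolatedᵇ
    adj≡ : ∀ i j → adj G i j ≡ (not (does (σ ⟨$⟩ʳ i ≟ σ ⟨$⟩ʳ j)) ∧ (toℕ (σ ⟨$⟩ʳ i) <ᵇ m) ∧ (toℕ (σ ⟨$⟩ʳ j) <ᵇ m))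
    adj≡ i j rewrite partitionPerm-<ᵇ nonIsolatedᵇ i | partitionPerm-<ᵇ nonIsolatedᵇ j with σ ⟨$⟩ʳ i ≟ σ ⟨$⟩ʳ j
    ... | yes σi≡σj with Injection.injective (↔⇒↣ σ) σi≡σj
    ...   | refl = irrefl G i
    adj≡ i j | no σi≢σj = clique⇒adj≡nonIsolatedᵇ∧nonIsolatedᵇ clique (σi≢σj ∘ cong (σ ⟨$⟩ʳ_))

KplusIsolated-nonIsolated⇒<ᵇ : ∀ {n m} {i : Fin n} → NonIsolated (KplusIsolated n m) i → (toℕ i <ᵇ m) ≡ true
KplusIsolated-nonIsolated⇒<ᵇ {m = m} {i} (i' , ii') =
  x∧y∧z≡true⇒y≡true (not (does (i ≟ i'))) (toℕ i <ᵇ m) (toℕ i' <ᵇ m) ii'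

KplusIsolated-isNonIsolatedClique : ∀ {n} m → NonIsolatedClique (KplusIsolated n m)
KplusIsolated-isNonIsolatedClique m {i} {j} i≢j ni nj = not[x]∧y∧z≡true
  (dec-false (i ≟ j) i≢j) (KplusIsolated-nonIsolated⇒<ᵇ {m = m} ni) (KplusIsolated-nonIsolated⇒<ᵇ {m = m} nj)

≅⇒clique : ∀ {n} {G H : Graph n} → G ≅ H → NonIsolatedClique H → NonIsolatedClique G
≅⇒clique (f , adj≡) cliqueH {x} {y} x≢y (x' , xx') (y' , yy') =
  trans (adj≡ x y) (cliqueH (x≢y ∘ Injection.injective (↔⇒↣ f))
                            (Inverse.to f x' , trans (≡-sym (adj≡ x x')) xx')
                            (Inverse.to f y' , trans (≡-sym (adj≡ y y')) yy'))

-- The witness r is the number of isolated vertices.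
≅KplusIsolated⇔clique : ∀ {n} (G : Graph n) → HasEdge G
  → (∃ λ r → 2 ≤ n ∸ r × G ≅ KplusIsolated n (n ∸ r)) ⇔ NonIsolatedClique G
≅KplusIsolated⇔clique {n} G edge = mk⇔ fromIso toIso
  where
  fromIso : (∃ λ r → 2 ≤ n ∸ r × G ≅ KplusIsolated n (n ∸ r)) → NonIsolatedClique G
  fromIso (r , _ , iso) = ≅⇒clique {G = G} {KplusIsolated n (n ∸ r)} iso (KplusIsolated-isNonIsolatedClique (n ∸ r))
  m : ℕ
  m = count (nonIsolatedᵇ G)
  n∸[n∸m]≡m : n ∸ (n ∸ m) ≡ m
  n∸[n∸m]≡m = m∸[m∸n]≡n (count≤n (nonIsolatedᵇ G))
  toIso : NonIsolatedClique G → ∃ λ r → 2 ≤ n ∸ r × G ≅ KplusIsolated n (n ∸ r)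
  toIso clique = n ∸ m , subst (2 ≤_) (≡-sym n∸[n∸m]≡m) (HasEdge⇒2≤count G edge) ,
                         subst (λ k → G ≅ KplusIsolated n k) (≡-sym n∸[n∸m]≡m) (clique⇒≅KplusIsolated G clique)

proposition3p17 : (n : ℕ) (G : Graph n) → 2 ≤ n → HasEdge G →
    let cond1 = ∃ λ r → 2 ≤ n ∸ r × G ≅ KplusIsolated n (n ∸ r) in
    (cond1 ⇔ z+ir≡ G (n ∸ 1))
    × (cond1 ⇔ Zplus≡ G (n ∸ 1))
    × (cond1 ⇔ ZplusBar≡ G (n ∸ 1))
    × (cond1 ⇔ Z+IR≡ G (n ∸ 1))
proposition3p17 n G 2≤n edge@(a , b , ab) =
  mk⇔ (clique⇒z+ir≡n∸1 G na) (z+ir≡n∸1⇒clique G 0<n) ⇔-∘ iso⇔clique ,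
  mk⇔ (clique⇒Zplus≡n∸1 G na) (Zplus≡n∸1⇒clique G) ⇔-∘ iso⇔clique ,
  mk⇔ (clique⇒ZplusBar≡n∸1 G na) (ZplusBar≡n∸1⇒clique G 0<n) ⇔-∘ iso⇔clique ,
  mk⇔ (clique⇒Z+IR≡n∸1 G na) (Z+IR≡n∸1⇒clique G 0<n) ⇔-∘ iso⇔clique
  where
  na : NonIsolated G a
  na = b , ab
  0<n : 0 < n
  0<n = ≤-trans (s≤s z≤n) 2≤n
  iso⇔clique : (∃ λ r → 2 ≤ n ∸ r × G ≅ KplusIsolated n (n ∸ r)) ⇔ NonIsolatedClique G
  iso⇔clique = ≅KplusIsolated⇔clique G edge
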